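{- Let $F, G$ be sets of ground clauses and let $N$ be a node of a leaf-closed two-sided clausal ground tableau for $F, G$. Then (i) $F \cup \mathrm{path}_{\mathsf F}(N) \models \mathrm{ipol}(N)$ and $G \cup \mathrm{path}_{\mathsf G}(N) \models \lnot \mathrm{ipol}(N)$; (ii) $\mathrm{Lit}(\mathrm{ipol}(N)) \subseteq \mathrm{Lit}(F \cup \mathrm{path}_{\mathsf F}(N)) \cap \overline{\mathrm{Lit}}(G \cup \mathrm{path}_{\mathsf G}(N))$.
   Context: Clauses are disjunctions of literals; sets of clauses are read as conjunctions. For a set $S$ of clauses/literals, $\mathrm{Lit}(S)$ is the set of literals occurring in $S$ and $\overline{\mathrm{Lit}}(S)$ the set of their complements; for an NNF formula $H$, $\mathrm{Lit}(H)$ is the set of literals occurring in it. A clausal tableau for a clause set $S$ is a finite ordered tree whose non-root nodes $N$ carry a literal $\mathrm{lit}(N)$ such that for each inner node $M$ the disjunction of the literals of its children (in order) is an instance of a clause in $S$; it is ground if all these clauses are ground. A branch is closed iff it contains nodes with complementary literals; the tableau is closed iff all branches are closed. A node is closing iff it has an ancestor with complementary literal; a particular such ancestor is associated as its target $\mathrm{tgt}(N)$. A tableau is leaf-closed iff it is closed and all closing nodes are leaves. A two-sided clausal tableau for $F, G$ is a clausal tableau for $F \cup G$ whose non-root nodes additionally carry a side $\mathrm{side}(N) \in \{\mathsf F, \mathsf G\}$ such that siblings have the same side and, if the children of $N$ have side $\mathsf F$ (resp. $\mathsf G$), the clause formed by the children of $N$ is an instance of a clause in $F$ (resp. $G$).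 For $\mathcal A \in \{\mathsf F,\mathsf G\}$, $\mathrm{path}_{\mathcal A}(N)$ is the set of $\mathrm{lit}(N')$ for nodes $N'$ on the path consisting of $N$ and its ancestors (excluding the root) with $\mathrm{side}(N') = \mathcal A$. Define simplified connectives: $\dot\bigwedge_{i} F_i$ is $\bot$ if some $F_i$ is $\bot$, else the conjunction of the $F_i$ not identical to $\top$ (empty conjunction $\top$); dually $\dot\bigvee_i F_i$ is $\top$ if some $F_i$ is $\top$, else the disjunction of those $F_i$ not identical to $\bot$ (empty disjunction $\bot$). $\mathrm{ipol}(N)$ is defined inductively: for a leaf $N$: if $\mathrm{side}(N)=\mathsf F$ and $\mathrm{side}(\mathrm{tgt}(N))=\mathsf F$ then $\bot$; if $\mathsf F,\mathsf G$ then $\mathrm{lit}(N)$; if $\mathsf G,\mathsf F$ then the complement of $\mathrm{lit}(N)$; if $\mathsf G,\mathsf G$ then $\top$. For an inner node $N$ with children $N_1,\dots,N_n$: if $\mathrm{side}(N_1)=\mathsf F$ then $\dot\bigvee_{i=1}^n \mathrm{ipol}(N_i)$, and if $\mathrm{side}(N_1)=\mathsf G$ then $\dot\bigwedge_{i=1}^n \mathrm{ipol}(N_i)$. -}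

module Defs where

open import Data.Bool using (Bool; true; false; not; _∧_; _∨_)
open import Data.List using (List; []; _∷_; map)
open import Data.List.Membership.Propositional using (_∈_)
open import Data.List.Relation.Unary.All using (All)
open import Data.List.Relation.Unary.Any using (Any)
open import Data.Maybe using (Maybe; just; nothing)
open import Data.Nat using (ℕ; zero; suc)
open import Data.Product using (_×_; _,_; Σ; proj₁)
open import Data.Sum using (_⊎_)
open import Relation.Binary.PropositionalEquality using (_≡_; _≢_)
open import Relation.Nullary using (¬_)

-- Ground literals and clauses over an arbitrary type A of ground atoms.
-- A literal is (polarity , atom); polarity true = positive.

Lit : Set → Set
Lit A = Bool × A

compl : {A : Set} → Lit A → Lit A
compl (b , a) = (not b , a)

Clause : Set → Set
Clause A = List (Lit A)

ClauseSet : Set → Set₁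
ClauseSet A = Clause A → Set

data Side : Set where
  sF sG : Side

sameSide : Side → Side → Bool
sameSide sF sF = true
sameSide sG sG = true
sameSide _  _  = false

data Fm (A : Set) : Set where
  ⊤ᶠ ⊥ᶠ : Fm A
  litᶠ  : Lit A → Fm A
  andᶠ  : List (Fm A) → Fm A
  orᶠ   : List (Fm A) → Fm A

module _ {A : Set} where

  isTop isBot : Fm A → Bool
  isTop ⊤ᶠ = true
  isTop _  = false
  isBot ⊥ᶠ = true
  isBot _  = false

  anyBot anyTop : List (Fm A) → Bool
  anyBot [] = false
  anyBot (f ∷ fs) = isBot f ∨ anyBot fs
  anyTop [] = false
  anyTop (f ∷ fs) = isTop f ∨ anyTop fs

  dropTop dropBot : List (Fm A) → List (Fm A)
  dropTop [] = []
  dropTop (⊤ᶠ ∷ fs) = dropTop fs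
  dropTop (f ∷ fs) = f ∷ dropTop fs
  dropBot [] = []
  dropBot (⊥ᶠ ∷ fs) = dropBot fs
  dropBot (f ∷ fs) = f ∷ dropBot fs

  mkAnd mkOr : List (Fm A) → Fm A
  mkAnd [] = ⊤ᶠ
  mkAnd (f ∷ []) = f
  mkAnd fs = andᶠ fs
  mkOr [] = ⊥ᶠ
  mkOr (f ∷ []) = f
  mkOr fs = orᶠ fs

  sAnd sOr : List (Fm A) → Fm A
  sAnd fs with anyBot fs
  ... | true  = ⊥ᶠ
  ... | false = mkAnd (dropTop fs)
  sOr fs with anyTop fs
  ... | true  = ⊤ᶠ
  ... | false = mkOr (dropBot fs)

  Interp : Set
  Interp = A → Bool

  evalLit : Interp → Lit A → Bool
  evalLit I (true  , a) = I a
  evalLit I (false , a) = not (I a)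

  mutual
    eval : Interp → Fm A → Bool
    eval I ⊤ᶠ = true
    eval I ⊥ᶠ = false
    eval I (litᶠ l) = evalLit I l
    eval I (andᶠ fs) = evalAnd I fs
    eval I (orᶠ fs) = evalOr I fs

    evalAnd evalOr : Interp → List (Fm A) → Bool
    evalAnd I [] = true
    evalAnd I (f ∷ fs) = eval I f ∧ evalAnd I fs
    evalOr I [] = false
    evalOr I (f ∷ fs) = eval I f ∨ evalOr I fs

  SatClause : Interp → Clause A → Set
  SatClause I C = Any (λ l → evalLit I l ≡ true) C

  Models : Interp → ClauseSet A → List (Lit A) → Set
  Models I S P = (∀ C → S C → SatClause I C) × All (λ l → evalLit I l ≡ true) P

  Entails : ClauseSet A → List (Lit A) → Fm A → Set
  Entails S P H = ∀ I → Models I S P → eval I H ≡ true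

  EntailsNeg : ClauseSet A → List (Lit A) → Fm A → Set
  EntailsNeg S P H = ∀ I → Models I S P → eval I H ≡ false

  data LitIn (l : Lit A) : Fm A → Set where
    inLit : LitIn l (litᶠ l)
    inAnd : ∀ {fs} → Any (LitIn l) fs → LitIn l (andᶠ fs)
    inOr  : ∀ {fs} → Any (LitIn l) fs → LitIn l (orᶠ fs)

  LitOcc : ClauseSet A → List (Lit A) → Lit A → Set
  LitOcc S P l = (Σ (Clause A) λ C → S C × l ∈ C) ⊎ l ∈ P

  LitOccBar : ClauseSet A → List (Lit A) → Lit A → Set
  LitOccBar S P l = LitOcc S P (compl l)

-- A non-root node carries a literal and a side.  A leaf additionally
-- carries the index of its target tgt(N) in the list of its (proper,
-- non-root) ancestors, nearest first (0 = parent).  Inner nodes have a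
-- nonempty list of children.

data Node (A : Set) : Set where
  inner : Lit A → Side → List (Node A) → Node A
  leaf  : Lit A → Side → ℕ → Node A

-- ancestors (literal , side), nearest first, root excluded
Anc : Set → Set
Anc A = List (Lit A × Side)

module _ {A : Set} where

  litN : Node A → Lit A
  litN (inner l _ _) = l
  litN (leaf l _ _) = l

  sideN : Node A → Side
  sideN (inner _ s _) = s
  sideN (leaf _ s _) = s

  firstSide : List (Node A) → Side
  firstSide [] = sF
  firstSide (c ∷ _) = sideN c

  lookupM : {X : Set} → List X → ℕ → Maybe X
  lookupM [] _ = nothing
  lookupM (x ∷ xs) zero = just x
  lookupM (x ∷ xs) (suc k) = lookupM xs k

  ClauseOf : ClauseSet A → ClauseSet A → Side → Clause A → Set
  ClauseOf F G sF C = F C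
  ClauseOf F G sG C = G C

  Expansion : ClauseSet A → ClauseSet A → List (Node A) → Set
  Expansion F G cs =
    (cs ≢ []) × All (λ c → sideN c ≡ firstSide cs) cs
              × ClauseOf F G (firstSide cs) (map litN cs)

  data WF (F G : ClauseSet A) (ctx : Anc A) : Node A → Set where
    wfLeaf  : ∀ {l s k t} → lookupM ctx k ≡ just (compl l , t) →
              WF F G ctx (leaf l s k)
    wfInner : ∀ {l s cs} → ¬ Any (λ p → proj₁ p ≡ compl l) ctx →
              Expansion F G cs →
              All (WF F G ((l , s) ∷ ctx)) cs →
              WF F G ctx (inner l s cs)

  -- A leaf-closed two-sided clausal ground tableau for F, G, given by the
  -- list of children of its root.
  LeafClosedTableau : ClauseSet A → ClauseSet A → List (Node A) → Set
  LeafClosedTableau F G cs = Expansion F G cs × All (WF F G []) cs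

  leafIpol : Side → Side → Lit A → Fm A
  leafIpol sF sF l = ⊥ᶠ
  leafIpol sF sG l = litᶠ l
  leafIpol sG sF l = litᶠ (compl l)
  leafIpol sG sG l = ⊤ᶠ

  combine : Side → List (Fm A) → Fm A
  combine sF = sOr
  combine sG = sAnd

  mutual
    ipol : Anc A → Node A → Fm A
    ipol ctx (leaf l s k) with lookupM ctx k
    ... | just (_ , t) = leafIpol s t l
    ... | nothing      = ⊥ᶠ   -- impossible in a well-formed tableau
    ipol ctx (inner l s cs) = combine (firstSide cs) (ipols ((l , s) ∷ ctx) cs)

    ipols : Anc A → List (Node A) → List (Fm A)
    ipols ctx [] = []
    ipols ctx (c ∷ cs) = ipol ctx c ∷ ipols ctx cs

  data Sub : Anc A → Node A → Anc A → Node A → Set where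
    here  : ∀ {ctx n} → Sub ctx n ctx n
    there : ∀ {ctx l s cs c ctx' m} → c ∈ cs →
            Sub ((l , s) ∷ ctx) c ctx' m → Sub ctx (inner l s cs) ctx' m

  -- a node of the tableau whose root has children cs
  data Pos (cs : List (Node A)) : Set where
    root    : Pos cs
    nonroot : ∀ {c ctx m} → c ∈ cs → Sub [] c ctx m → Pos cs

  selectSide : Side → Anc A → List (Lit A)
  selectSide 𝒜 [] = []
  selectSide 𝒜 ((l , s) ∷ xs) with sameSide 𝒜 s
  ... | true  = l ∷ selectSide 𝒜 xs
  ... | false = selectSide 𝒜 xs

  ipolAt : (cs : List (Node A)) → Pos cs → Fm A
  ipolAt cs root = combine (firstSide cs) (ipols [] cs)
  ipolAt cs (nonroot {ctx = ctx} {m = m} _ _) = ipol ctx m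

  pathAt : Side → (cs : List (Node A)) → Pos cs → List (Lit A)
  pathAt 𝒜 cs root = []
  pathAt 𝒜 cs (nonroot {ctx = ctx} {m = m} _ _) =
    selectSide 𝒜 ((litN m , sideN m) ∷ ctx)

{-# OPTIONS --safe #-}
module Submission where

-- At a leaf N whose target
-- carries the complementary literal, the interpolant ⊥, lit N, its complement
-- or ⊤ works because no model makes both lit N and its complement true, and
-- the complementary literal lies on the path of the target's side.  At an
-- inner node expanded by a clause of F, every model of F and the F-path
-- satisfies some child literal, hence that child's interpolant, while a model
-- of G and the G-path (unchanged by F-children) falsifies all of them; so the
-- disjunction interpolates.  Its literals stay shared because a child literal
-- added to the F-path already occurs in the clause of F.  Expansions by
-- clauses of G are dual, with conjunction.

open import Defs
open import Data.Bool using (true; false; not; _∨_; _∧_)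
open import Data.Bool.Properties
  using (not-involutive; not-injective; ∨-zeroʳ; ∨-identityʳ; ∧-zeroʳ; ∧-identityʳ)
open import Data.Empty using (⊥; ⊥-elim)
open import Data.List using (List; []; _∷_; map)
open import Data.List.Membership.Propositional using (_∈_; find; lose)
open import Data.List.Membership.Propositional.Properties using (∈-map⁺)
open import Data.List.Relation.Unary.All as All using (All; []; _∷_)
import Data.List.Relation.Unary.All.Properties as Allₚ
open import Data.List.Relation.Unary.Any using (Any; here; there)
import Data.List.Relation.Unary.Any.Properties as Anyₚ
open import Data.Maybe using (just)
open import Data.Nat using (zero; suc)
open import Data.Product using (_×_; _,_)
open import Data.Sum using (_⊎_; inj₁; inj₂)
open import Relation.Binary.PropositionalEquality using (_≡_; refl; sym; trans; cong; subst)

module _ {A : Set} where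

  compl-involutive : (l : Lit A) → compl (compl l) ≡ l
  compl-involutive (b , a) = cong (_, a) (not-involutive b)

  evalLit-compl : (I : Interp) (l : Lit A) → evalLit I (compl l) ≡ not (evalLit I l)
  evalLit-compl I (true  , a) = refl
  evalLit-compl I (false , a) = sym (not-involutive (I a))

  evalLit-compl-true : (I : Interp) (l : Lit A) →
    evalLit I (compl l) ≡ true → evalLit I l ≡ false
  evalLit-compl-true I l l̄✓ = not-injective (trans (sym (evalLit-compl I l)) l̄✓)

  evalLit-compl-false : (I : Interp) (l : Lit A) →
    evalLit I l ≡ true → evalLit I (compl l) ≡ false
  evalLit-compl-false I l l✓ = trans (evalLit-compl I l) (cong not l✓)

  evalLit-clash : (I : Interp) (l : Lit A) →
    evalLit I l ≡ true → evalLit I (compl l) ≡ true → ⊥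
  evalLit-clash I l l✓ l̄✓ with trans (sym l✓) (evalLit-compl-true I l l̄✓)
  ... | ()

  evalOr-true : ∀ {I : Interp} {fs : List (Fm A)} →
    Any (λ f → eval I f ≡ true) fs → evalOr I fs ≡ true
  evalOr-true (here f✓) rewrite f✓ = refl
  evalOr-true {I} {f ∷ _} (there fs✓) rewrite evalOr-true fs✓ = ∨-zeroʳ (eval I f)

  evalOr-false : ∀ {I : Interp} {fs : List (Fm A)} →
    All (λ f → eval I f ≡ false) fs → evalOr I fs ≡ false
  evalOr-false [] = refl
  evalOr-false (f✗ ∷ fs✗) rewrite f✗ | evalOr-false fs✗ = refl

  evalAnd-false : ∀ {I : Interp} {fs : List (Fm A)} →
    Any (λ f → eval I f ≡ false) fs → evalAnd I fs ≡ false
  evalAnd-false (here f✗) rewrite f✗ = refl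
  evalAnd-false {I} {f ∷ _} (there fs✗) rewrite evalAnd-false fs✗ = ∧-zeroʳ (eval I f)

  evalAnd-true : ∀ {I : Interp} {fs : List (Fm A)} →
    All (λ f → eval I f ≡ true) fs → evalAnd I fs ≡ true
  evalAnd-true [] = refl
  evalAnd-true (f✓ ∷ fs✓) rewrite f✓ | evalAnd-true fs✓ = refl

  anyTop⇒⊤∈ : ∀ {fs : List (Fm A)} → anyTop fs ≡ true → ⊤ᶠ ∈ fs
  anyTop⇒⊤∈ {⊤ᶠ     ∷ _} _ = here refl
  anyTop⇒⊤∈ {⊥ᶠ     ∷ _} e = there (anyTop⇒⊤∈ e)
  anyTop⇒⊤∈ {litᶠ _ ∷ _} e = there (anyTop⇒⊤∈ e)
  anyTop⇒⊤∈ {andᶠ _ ∷ _} e = there (anyTop⇒⊤∈ e)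
  anyTop⇒⊤∈ {orᶠ _  ∷ _} e = there (anyTop⇒⊤∈ e)

  anyBot⇒⊥∈ : ∀ {fs : List (Fm A)} → anyBot fs ≡ true → ⊥ᶠ ∈ fs
  anyBot⇒⊥∈ {⊥ᶠ     ∷ _} _ = here refl
  anyBot⇒⊥∈ {⊤ᶠ     ∷ _} e = there (anyBot⇒⊥∈ e)
  anyBot⇒⊥∈ {litᶠ _ ∷ _} e = there (anyBot⇒⊥∈ e)
  anyBot⇒⊥∈ {andᶠ _ ∷ _} e = there (anyBot⇒⊥∈ e)
  anyBot⇒⊥∈ {orᶠ _  ∷ _} e = there (anyBot⇒⊥∈ e)

  dropBot-∷ : (f : Fm A) (fs : List (Fm A)) →
    f ≡ ⊥ᶠ ⊎ dropBot (f ∷ fs) ≡ f ∷ dropBot fs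
  dropBot-∷ ⊤ᶠ       _ = inj₂ refl
  dropBot-∷ ⊥ᶠ       _ = inj₁ refl
  dropBot-∷ (litᶠ _) _ = inj₂ refl
  dropBot-∷ (andᶠ _) _ = inj₂ refl
  dropBot-∷ (orᶠ _)  _ = inj₂ refl

  dropTop-∷ : (f : Fm A) (fs : List (Fm A)) →
    f ≡ ⊤ᶠ ⊎ dropTop (f ∷ fs) ≡ f ∷ dropTop fs
  dropTop-∷ ⊤ᶠ       _ = inj₁ refl
  dropTop-∷ ⊥ᶠ       _ = inj₂ refl
  dropTop-∷ (litᶠ _) _ = inj₂ refl
  dropTop-∷ (andᶠ _) _ = inj₂ refl
  dropTop-∷ (orᶠ _)  _ = inj₂ refl

  evalOr-dropBot : (I : Interp) (fs : List (Fm A)) → evalOr I (dropBot fs) ≡ evalOr I fs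
  evalOr-dropBot I [] = refl
  evalOr-dropBot I (f ∷ fs) with dropBot-∷ f fs
  ... | inj₁ refl = evalOr-dropBot I fs
  ... | inj₂ eq rewrite eq = cong (eval I f ∨_) (evalOr-dropBot I fs)

  evalAnd-dropTop : (I : Interp) (fs : List (Fm A)) → evalAnd I (dropTop fs) ≡ evalAnd I fs
  evalAnd-dropTop I [] = refl
  evalAnd-dropTop I (f ∷ fs) with dropTop-∷ f fs
  ... | inj₁ refl = evalAnd-dropTop I fs
  ... | inj₂ eq rewrite eq = cong (eval I f ∧_) (evalAnd-dropTop I fs)

  Any-dropBot⁻ : ∀ {P : Fm A → Set} {fs} → Any P (dropBot fs) → Any P fs
  Any-dropBot⁻ {P} {f ∷ fs} p with dropBot-∷ f fs
  ... | inj₁ refl = there (Any-dropBot⁻ p)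
  ... | inj₂ eq with subst (Any P) eq p
  ...   | here  pf  = here pf
  ...   | there pfs = there (Any-dropBot⁻ pfs)

  Any-dropTop⁻ : ∀ {P : Fm A → Set} {fs} → Any P (dropTop fs) → Any P fs
  Any-dropTop⁻ {P} {f ∷ fs} p with dropTop-∷ f fs
  ... | inj₁ refl = there (Any-dropTop⁻ p)
  ... | inj₂ eq with subst (Any P) eq p
  ...   | here  pf  = here pf
  ...   | there pfs = there (Any-dropTop⁻ pfs)

  eval-mkOr : (I : Interp) (fs : List (Fm A)) → eval I (mkOr fs) ≡ evalOr I fs
  eval-mkOr I []          = refl
  eval-mkOr I (f ∷ [])    = sym (∨-identityʳ (eval I f))
  eval-mkOr I (_ ∷ _ ∷ _) = refl

  eval-mkAnd : (I : Interp) (fs : List (Fm A)) → eval I (mkAnd fs) ≡ evalAnd I fs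
  eval-mkAnd I []          = refl
  eval-mkAnd I (f ∷ [])    = sym (∧-identityʳ (eval I f))
  eval-mkAnd I (_ ∷ _ ∷ _) = refl

  LitIn-mkOr⁻ : ∀ {l : Lit A} fs → LitIn l (mkOr fs) → Any (LitIn l) fs
  LitIn-mkOr⁻ (_ ∷ [])    l∈        = here l∈
  LitIn-mkOr⁻ (_ ∷ _ ∷ _) (inOr l∈) = l∈

  LitIn-mkAnd⁻ : ∀ {l : Lit A} fs → LitIn l (mkAnd fs) → Any (LitIn l) fs
  LitIn-mkAnd⁻ (_ ∷ [])    l∈         = here l∈
  LitIn-mkAnd⁻ (_ ∷ _ ∷ _) (inAnd l∈) = l∈

  eval-sOr : (I : Interp) (fs : List (Fm A)) → eval I (sOr fs) ≡ evalOr I fs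
  eval-sOr I fs with anyTop fs in e
  ... | true  = sym (evalOr-true {I} (lose (anyTop⇒⊤∈ {fs} e) refl))
  ... | false = trans (eval-mkOr I (dropBot fs)) (evalOr-dropBot I fs)

  eval-sAnd : (I : Interp) (fs : List (Fm A)) → eval I (sAnd fs) ≡ evalAnd I fs
  eval-sAnd I fs with anyBot fs in e
  ... | true  = sym (evalAnd-false {I} (lose (anyBot⇒⊥∈ {fs} e) refl))
  ... | false = trans (eval-mkAnd I (dropTop fs)) (evalAnd-dropTop I fs)

  LitIn-sOr⁻ : ∀ {l : Lit A} fs → LitIn l (sOr fs) → Any (LitIn l) fs
  LitIn-sOr⁻ fs l∈ with anyTop fs
  LitIn-sOr⁻ fs () | true
  ... | false = Any-dropBot⁻ (LitIn-mkOr⁻ (dropBot fs) l∈)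

  LitIn-sAnd⁻ : ∀ {l : Lit A} fs → LitIn l (sAnd fs) → Any (LitIn l) fs
  LitIn-sAnd⁻ fs l∈ with anyBot fs
  LitIn-sAnd⁻ fs () | true
  ... | false = Any-dropTop⁻ (LitIn-mkAnd⁻ (dropTop fs) l∈)

  ipols≡map : (ctx : Anc A) (cs : List (Node A)) → ipols ctx cs ≡ map (ipol ctx) cs
  ipols≡map ctx []       = refl
  ipols≡map ctx (c ∷ cs) = cong (ipol ctx c ∷_) (ipols≡map ctx cs)

  -- lookupM is parametrised by a type A it never uses, so A must be given.
  ipol-leaf : ∀ {ctx : Anc A} {k x t l s} →
    lookupM {A = A} ctx k ≡ just (x , t) → ipol ctx (leaf l s k) ≡ leafIpol s t l
  ipol-leaf eq rewrite eq = refl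

  selectSide-here : ∀ 𝒜 (x : Lit A) ctx → x ∈ selectSide 𝒜 ((x , 𝒜) ∷ ctx)
  selectSide-here sF _ _ = here refl
  selectSide-here sG _ _ = here refl

  selectSide-there : ∀ 𝒜 {x : Lit A} p ctx →
    x ∈ selectSide 𝒜 ctx → x ∈ selectSide 𝒜 (p ∷ ctx)
  selectSide-there 𝒜 (_ , s) _ x∈ with sameSide 𝒜 s
  ... | true  = there x∈
  ... | false = x∈

  lookupM⇒∈selectSide : ∀ (ctx : Anc A) k {x t} →
    lookupM {A = A} ctx k ≡ just (x , t) → x ∈ selectSide t ctx
  lookupM⇒∈selectSide ((x , t) ∷ ctx) zero    refl = selectSide-here t x ctx
  lookupM⇒∈selectSide (p       ∷ ctx) (suc k) eq   =
    selectSide-there _ p ctx (lookupM⇒∈selectSide ctx k eq)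

  LitOcc-∷⁻ : ∀ {S : ClauseSet A} {P C x l} →
    S C → x ∈ C → LitOcc S (x ∷ P) l → LitOcc S P l
  LitOcc-∷⁻ _         _   (inj₁ occ)         = inj₁ occ
  LitOcc-∷⁻ {C = C} S∋C x∈C (inj₂ (here refl))  = inj₁ (C , S∋C , x∈C)
  LitOcc-∷⁻ _         _   (inj₂ (there l∈P)) = inj₂ l∈P

module Interpolation {A : Set} (F G : ClauseSet A) where

  record IsInterpolant (PF PG : List (Lit A)) (H : Fm A) : Set where
    field
      F-entails : Entails F PF H
      G-refutes : EntailsNeg G PG H
      shared    : ∀ l → LitIn l H → LitOcc F PF l × LitOccBar G PG l

  open IsInterpolant

  InterpolantAt : Anc A → Fm A → Set
  InterpolantAt ctx = IsInterpolant (selectSide sF ctx) (selectSide sG ctx)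

  NodeInterpolant : Anc A → Node A → Set
  NodeInterpolant ctx n = InterpolantAt ((litN n , sideN n) ∷ ctx) (ipol ctx n)

  leafIpol-interpolant : ∀ {ctx l} s t → compl l ∈ selectSide t ctx →
    InterpolantAt ((l , s) ∷ ctx) (leafIpol s t l)
  leafIpol-interpolant {l = l} sF sF l̄∈ = record
    { F-entails = λ { I (_ , l✓ ∷ P✓) →
        ⊥-elim (evalLit-clash I l l✓ (All.lookup P✓ l̄∈)) }
    ; G-refutes = λ _ _ → refl
    ; shared    = λ _ ()
    }
  leafIpol-interpolant {l = l} sF sG l̄∈ = record
    { F-entails = λ { I (_ , l✓ ∷ _) → l✓ }
    ; G-refutes = λ { I (_ , P✓) → evalLit-compl-true I l (All.lookup P✓ l̄∈) }
    ; shared    = λ { _ inLit → inj₂ (here refl) , inj₂ l̄∈ }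
    }
  leafIpol-interpolant {l = l} sG sF l̄∈ = record
    { F-entails = λ { I (_ , P✓) → All.lookup P✓ l̄∈ }
    ; G-refutes = λ { I (_ , l✓ ∷ _) → evalLit-compl-false I l l✓ }
    ; shared    = λ { _ inLit → inj₂ l̄∈ , inj₂ (here (compl-involutive l)) }
    }
  leafIpol-interpolant {l = l} sG sG l̄∈ = record
    { F-entails = λ _ _ → refl
    ; G-refutes = λ { I (_ , l✓ ∷ P✓) →
        ⊥-elim (evalLit-clash I l l✓ (All.lookup P✓ l̄∈)) }
    ; shared    = λ _ ()
    }

  sOr-interpolant : ∀ {ctx cs} → F (map litN cs) →
    All (λ c → InterpolantAt ((litN c , sF) ∷ ctx) (ipol ctx c)) cs →
    InterpolantAt ctx (sOr (map (ipol ctx) cs))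
  sOr-interpolant {ctx} {cs} F∋C children = record
    { F-entails = λ I M → trans (eval-sOr I (map (ipol ctx) cs))
        (evalOr-true (Anyₚ.map⁺ (some-child-true I M)))
    ; G-refutes = λ I M → trans (eval-sOr I (map (ipol ctx) cs))
        (evalOr-false (Allₚ.map⁺ (All.map (λ i → G-refutes i I M) children)))
    ; shared    = λ l l∈ →
        let c , c∈cs , l∈c = find (Anyₚ.map⁻ (LitIn-sOr⁻ _ l∈))
            occF , occG    = shared (All.lookup children c∈cs) l l∈c
        in LitOcc-∷⁻ F∋C (∈-map⁺ litN c∈cs) occF , occG
    }
    where
    some-child-true : ∀ I → Models I F (selectSide sF ctx) →
      Any (λ c → eval I (ipol ctx c) ≡ true) cs
    some-child-true I (F✓ , P✓) =
      let c , c∈cs , c✓ = find (Anyₚ.map⁻ (F✓ _ F∋C))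
      in lose c∈cs (F-entails (All.lookup children c∈cs) I (F✓ , c✓ ∷ P✓))

  sAnd-interpolant : ∀ {ctx cs} → G (map litN cs) →
    All (λ c → InterpolantAt ((litN c , sG) ∷ ctx) (ipol ctx c)) cs →
    InterpolantAt ctx (sAnd (map (ipol ctx) cs))
  sAnd-interpolant {ctx} {cs} G∋C children = record
    { F-entails = λ I M → trans (eval-sAnd I (map (ipol ctx) cs))
        (evalAnd-true (Allₚ.map⁺ (All.map (λ i → F-entails i I M) children)))
    ; G-refutes = λ I M → trans (eval-sAnd I (map (ipol ctx) cs))
        (evalAnd-false (Anyₚ.map⁺ (some-child-false I M)))
    ; shared    = λ l l∈ →
        let c , c∈cs , l∈c = find (Anyₚ.map⁻ (LitIn-sAnd⁻ _ l∈))
            occF , occG    = shared (All.lookup children c∈cs) l l∈c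
        in occF , LitOcc-∷⁻ G∋C (∈-map⁺ litN c∈cs) occG
    }
    where
    some-child-false : ∀ I → Models I G (selectSide sG ctx) →
      Any (λ c → eval I (ipol ctx c) ≡ false) cs
    some-child-false I (G✓ , P✓) =
      let c , c∈cs , c✓ = find (Anyₚ.map⁻ (G✓ _ G∋C))
      in lose c∈cs (G-refutes (All.lookup children c∈cs) I (G✓ , c✓ ∷ P✓))

  clause-interpolant : ∀ {ctx cs} s → ClauseOf F G s (map litN cs) →
    All (λ c → InterpolantAt ((litN c , s) ∷ ctx) (ipol ctx c)) cs →
    InterpolantAt ctx (combine s (ipols ctx cs))
  clause-interpolant {ctx} {cs} sF C∈ children
    rewrite ipols≡map ctx cs = sOr-interpolant C∈ children
  clause-interpolant {ctx} {cs} sG C∈ children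
    rewrite ipols≡map ctx cs = sAnd-interpolant C∈ children

  expansion-interpolant : ∀ {ctx cs} → Expansion F G cs → All (NodeInterpolant ctx) cs →
    InterpolantAt ctx (combine (firstSide cs) (ipols ctx cs))
  expansion-interpolant {ctx} {cs} (_ , sides , C∈) children =
    clause-interpolant {ctx} (firstSide cs) C∈
      (All.zipWith (λ {c} → on-side {c}) (sides , children))
    where
    on-side : ∀ {c s} → sideN c ≡ s × NodeInterpolant ctx c →
      InterpolantAt ((litN c , s) ∷ ctx) (ipol ctx c)
    on-side (refl , i) = i

  mutual
    WF-interpolant : ∀ {ctx n} → WF F G ctx n → NodeInterpolant ctx n
    WF-interpolant {ctx} (wfLeaf {l} {s} {k} {t} eq) =
      subst (InterpolantAt ((l , s) ∷ ctx)) (sym (ipol-leaf {ctx = ctx} {k = k} eq))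
            (leafIpol-interpolant s t (lookupM⇒∈selectSide ctx k eq))
    WF-interpolant (wfInner _ expansion ws) =
      expansion-interpolant expansion (WF-interpolants ws)

    WF-interpolants : ∀ {ctx cs} → All (WF F G ctx) cs → All (NodeInterpolant ctx) cs
    WF-interpolants []       = []
    WF-interpolants (w ∷ ws) = WF-interpolant w ∷ WF-interpolants ws

  WF-Sub : ∀ {ctx n ctx′ m} → WF F G ctx n → Sub ctx n ctx′ m → WF F G ctx′ m
  WF-Sub w                here             = w
  WF-Sub (wfInner _ _ ws) (there c∈cs sub) = WF-Sub (All.lookup ws c∈cs) sub

mainTheorem2 : {A : Set} (F G : ClauseSet A) (cs : List (Node A)) →
    LeafClosedTableau F G cs → (N : Pos cs) →
    (Entails F (pathAt sF cs N) (ipolAt cs N)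
      × EntailsNeg G (pathAt sG cs N) (ipolAt cs N))
    × (∀ l → LitIn l (ipolAt cs N) →
         LitOcc F (pathAt sF cs N) l × LitOccBar G (pathAt sG cs N) l)
mainTheorem2 F G cs (expansion , wfs) N =
  (F-entails (interpolant N) , G-refutes (interpolant N)) , shared (interpolant N)
  where
  open Interpolation F G
  open IsInterpolant

  interpolant : (N : Pos cs) → IsInterpolant (pathAt sF cs N) (pathAt sG cs N) (ipolAt cs N)
  interpolant root               = expansion-interpolant expansion (WF-interpolants wfs)
  interpolant (nonroot c∈cs sub) = WF-interpolant (WF-Sub (All.lookup wfs c∈cs) sub)
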